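{- Let $G=(V,E)$ be a directed graph, $s\neq t$ vertices, $k$ a positive integer, and let $p^\ast=\{s=v_0,v_1,\ldots,v_l=t\}$ be a simple path from $s$ to $t$ of length $l\le k$. Then each of its first two edges and last two edges (i.e., each edge $(v_{i-1},v_i)$ with $i\in\{1,2,l-1,l\}$, $1\le i\le l$) is a definite edge.
   Context: A path from $x$ to $y$ is a vertex sequence $x=v_0,\ldots,v_l=y$ with $(v_{i-1},v_i)\in E$; its length is $l$ (length $0$ allowed); $V(p)$ is its vertex set; it is simple if its vertices are pairwise distinct. $P_l^\ast(x,y)$ is the set of simple paths from $x$ to $y$ of length at most $l$. Essential vertices: $EV_l^\ast(s,u)=\bigcap\{V(p): p\in P_l^\ast(s,u),\ t\notin V(p)\}$ and $EV_l^\ast(v,t)=\bigcap\{V(p): p\in P_l^\ast(v,t),\ s\notin V(p)\}$; $EV_l^\ast(s,u)$ exists iff some $p\in P_l^\ast(s,u)$ has $t\notin V(p)$, and $EV_l^\ast(v,t)$ exists iff some $p\in P_l^\ast(v,t)$ has $s\notin V(p)$. An edge $(u,v)\in E$ is a definite edge (for $s,t,k$) if at least one of the following holds: (a) $u=s$ and $EV^\ast_{k-1}(v,t)$ exists; (b) $v=t$ and $EV^\ast_{k-1}(s,u)$ exists; (c) $EV^\ast_1(s,u)$ and $EV^\ast_{k-2}(v,t)$ exist and $u\notin EV^\ast_{k-2}(v,t)$; (d) $EV^\ast_1(v,t)$ and $EV^\ast_{k-2}(s,u)$ exist and $v\notin EV^\ast_{k-2}(s,u)$. -}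

module Defs where

open import Data.Nat using (ℕ; suc; _≤_; _∸_)
open import Data.Fin using (Fin; inject₁; fromℕ)
open import Data.Product using (Σ; ∃; _×_)
open import Data.Sum using (_⊎_)
open import Relation.Binary.PropositionalEquality using (_≡_)
open import Relation.Nullary using (¬_)
open import Function.Definitions using (Injective)

record Path {V : Set} (E : V → V → Set) (x y : V) : Set where
  field
    len   : ℕ
    vert  : Fin (suc len) → V
    start : vert Fin.zero ≡ x
    end   : vert (fromℕ len) ≡ y
    step  : (i : Fin len) → E (vert (inject₁ i)) (vert (Fin.suc i))
open Path public

_∈V_ : {V : Set} {E : V → V → Set} {x y : V} → V → Path E x y → Set
w ∈V p = ∃ λ i → vert p i ≡ w

Simple : {V : Set} {E : V → V → Set} {x y : V} → Path E x y → Set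
Simple p = Injective _≡_ _≡_ (vert p)

InP* : {V : Set} (E : V → V → Set) (l : ℕ) (x y : V) → Path E x y → Set
InP* E l x y p = Simple p × len p ≤ l

EVsExists : {V : Set} (E : V → V → Set) (s t : V) (l : ℕ) (u : V) → Set
EVsExists E s t l u = Σ (Path E s u) λ p → InP* E l s u p × ¬ (t ∈V p)

InEVs : {V : Set} (E : V → V → Set) (s t : V) (l : ℕ) (u : V) → V → Set
InEVs E s t l u w = (p : Path E s u) → InP* E l s u p → ¬ (t ∈V p) → w ∈V p

EVtExists : {V : Set} (E : V → V → Set) (s t : V) (l : ℕ) (v : V) → Set
EVtExists E s t l v = Σ (Path E v t) λ p → InP* E l v t p × ¬ (s ∈V p)

InEVt : {V : Set} (E : V → V → Set) (s t : V) (l : ℕ) (v : V) → V → Set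
InEVt E s t l v w = (p : Path E v t) → InP* E l v t p → ¬ (s ∈V p) → w ∈V p

-- The indices k-1 and k-2 are genuine integers in the
-- paper; P*_{-1} is empty, so we require 1 ≤ k (resp. 2 ≤ k) explicitly, after which
-- truncated subtraction ∸ is exact.
DefiniteEdge : {V : Set} (E : V → V → Set) (s t : V) (k : ℕ) (u v : V) → Set
DefiniteEdge E s t k u v =
  E u v ×
  ( (u ≡ s × 1 ≤ k × EVtExists E s t (k ∸ 1) v)
  ⊎ (v ≡ t × 1 ≤ k × EVsExists E s t (k ∸ 1) u)
  ⊎ (2 ≤ k × EVsExists E s t 1 u × EVtExists E s t (k ∸ 2) v × ¬ InEVt E s t (k ∸ 2) v u)
  ⊎ (2 ≤ k × EVtExists E s t 1 v × EVsExists E s t (k ∸ 2) u × ¬ InEVs E s t (k ∸ 2) u v))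

module Submission where

open import Defs
open import Data.Nat using (ℕ; zero; suc; _+_; _∸_; _≤_; _<_; z≤n; s≤s)
open import Data.Nat.Properties
  using (≤-refl; ≤-trans; ≤-reflexive; <-≤-trans; <⇒≤; <⇒≱; n<1+n; n≤1+n; m≤m+n;
         +-identityʳ; +-suc; +-cancelˡ-≡; +-monoʳ-≤; +-monoʳ-<; m+[n∸m]≡n; m+n∸n≡m; ∸-monoˡ-≤)
open import Data.Fin using (Fin; toℕ; inject₁; fromℕ; fromℕ<)
open import Data.Fin.Properties using (toℕ-injective; toℕ<n; toℕ≤pred[n]; toℕ-fromℕ; toℕ-fromℕ<; toℕ-inject₁)
open import Data.Product using (_,_; _×_; proj₁; proj₂)
open import Data.Sum using (_⊎_; inj₁; inj₂)
open import Relation.Binary.PropositionalEquality using (_≡_; refl; sym; trans; cong; subst; subst₂)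
open import Relation.Nullary using (¬_)

-- Every segment v_a … v_b of p is a simple
-- path of length b − a containing no other vertex of p.  For the edge (v_i , v_{i+1}), the suffix
-- v_{i+1} … v_l avoids s and v_i, and the prefix v₀ … v_i avoids t and v_{i+1}.  For i = 0 and
-- i = l − 1 these witness clauses (a) and (b); for i = 1 the prefix v₀ v₁ together with the suffix
-- (which shows v₁ is not essential) gives (c), and symmetrically i = l − 2 gives (d).

+-offset-< : ∀ {a b c} → a ≤ b → c < b ∸ a → a + c < b
+-offset-< {a} a≤b c<b∸a = subst (a + _ <_) (m+[n∸m]≡n a≤b) (+-monoʳ-< a c<b∸a)

+-offset-≤ : ∀ {a b c} → a ≤ b → c ≤ b ∸ a → a + c ≤ b
+-offset-≤ {a} a≤b c≤b∸a = subst (a + _ ≤_) (m+[n∸m]≡n a≤b) (+-monoʳ-≤ a c≤b∸a)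

-- clamp n j = min j n, so that the vertices of a path can be indexed by naturals.
clamp : (n : ℕ) → ℕ → Fin (suc n)
clamp n       zero    = Fin.zero
clamp zero    (suc j) = Fin.zero
clamp (suc n) (suc j) = Fin.suc (clamp n j)

toℕ-clamp : ∀ {n j} → j ≤ n → toℕ (clamp n j) ≡ j
toℕ-clamp {n}     {zero}  _         = refl
toℕ-clamp {suc n} {suc j} (s≤s j≤n) = cong suc (toℕ-clamp j≤n)

clamp-toℕ : ∀ {n} (x : Fin (suc n)) → clamp n (toℕ x) ≡ x
clamp-toℕ {n}     Fin.zero    = refl
clamp-toℕ {suc n} (Fin.suc x) = cong Fin.suc (clamp-toℕ x)

-- Rewriting an endpoint keeps vert, so simplicity and membership carry over definitionally.
relabelStart : ∀ {V} {E : V → V → Set} {x x′ y} → x ≡ x′ → Path E x y → Path E x′ y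
relabelStart x≡x′ q = record
  { len = len q ; vert = vert q ; start = trans (start q) x≡x′ ; end = end q ; step = step q }

relabelEnd : ∀ {V} {E : V → V → Set} {x y y′} → y ≡ y′ → Path E x y → Path E x y′
relabelEnd y≡y′ q = record
  { len = len q ; vert = vert q ; start = start q ; end = trans (end q) y≡y′ ; step = step q }

module Segments {V : Set} {E : V → V → Set} {x y : V} (p : Path E x y) where

  vertexAt : ℕ → V
  vertexAt j = vert p (clamp (len p) j)

  vert≡vertexAt : ∀ {j} (i : Fin (suc (len p))) → toℕ i ≡ j → vert p i ≡ vertexAt j
  vert≡vertexAt i refl = cong (vert p) (sym (clamp-toℕ i))

  vertexAt-zero : vertexAt 0 ≡ x
  vertexAt-zero = start p

  vertexAt-len : vertexAt (len p) ≡ y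
  vertexAt-len = trans (sym (vert≡vertexAt (fromℕ (len p)) (toℕ-fromℕ (len p)))) (end p)

  vertexAt-step : ∀ {j} → j < len p → E (vertexAt j) (vertexAt (suc j))
  vertexAt-step j<l = subst₂ E
    (vert≡vertexAt (inject₁ i) (trans (toℕ-inject₁ i) (toℕ-fromℕ< j<l)))
    (vert≡vertexAt (Fin.suc i) (cong suc (toℕ-fromℕ< j<l)))
    (step p i)
    where i = fromℕ< j<l

  vertexAt-injective : Simple p → ∀ {a b} → a ≤ len p → b ≤ len p → vertexAt a ≡ vertexAt b → a ≡ b
  vertexAt-injective sp {a} {b} a≤l b≤l eq =
    trans (sym (toℕ-clamp a≤l)) (trans (cong toℕ (sp eq)) (toℕ-clamp b≤l))

  module _ {a b : ℕ} (a≤b : a ≤ b) (b≤l : b ≤ len p) where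

    offset≤len : (i : Fin (suc (b ∸ a))) → a + toℕ i ≤ len p
    offset≤len i = ≤-trans (+-offset-≤ a≤b (toℕ≤pred[n] i)) b≤l

    segment : Path E (vertexAt a) (vertexAt b)
    segment = record
      { len   = b ∸ a
      ; vert  = λ i → vertexAt (a + toℕ i)
      ; start = cong vertexAt (+-identityʳ a)
      ; end   = cong vertexAt (trans (cong (a +_) (toℕ-fromℕ (b ∸ a))) (m+[n∸m]≡n a≤b))
      ; step  = λ i → subst₂ E
          (cong (λ c → vertexAt (a + c)) (sym (toℕ-inject₁ i)))
          (cong vertexAt (sym (+-suc a (toℕ i))))
          (vertexAt-step (<-≤-trans (+-offset-< a≤b (toℕ<n i)) b≤l))
      }

    segment-simple : Simple p → Simple segment
    segment-simple sp {i} {j} eq =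
      toℕ-injective (+-cancelˡ-≡ a _ _ (vertexAt-injective sp (offset≤len i) (offset≤len j) eq))

    segment-∈V : Simple p → ∀ {m} → m ≤ len p → vertexAt m ∈V segment → a ≤ m × m ≤ b
    segment-∈V sp m≤l (i , eq) =
      subst (a ≤_) a+i≡m (m≤m+n a (toℕ i)) , subst (_≤ b) a+i≡m (+-offset-≤ a≤b (toℕ≤pred[n] i))
      where a+i≡m = vertexAt-injective sp (offset≤len i) m≤l eq

  prefix : ∀ {b} → b ≤ len p → Path E x (vertexAt b)
  prefix b≤l = relabelStart vertexAt-zero (segment z≤n b≤l)

  suffix : ∀ {a} → a ≤ len p → Path E (vertexAt a) y
  suffix a≤l = relabelEnd vertexAt-len (segment a≤l ≤-refl)

  prefix-∌-end : Simple p → ∀ {b} → (b<l : b < len p) → ¬ (y ∈V prefix (<⇒≤ b<l))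
  prefix-∌-end sp b<l y∈ =
    <⇒≱ b<l (proj₂ (segment-∈V z≤n (<⇒≤ b<l) sp ≤-refl (subst (_∈V prefix (<⇒≤ b<l)) (sym vertexAt-len) y∈)))

  suffix-∌-start : Simple p → ∀ {a} → 0 < a → (a≤l : a ≤ len p) → ¬ (x ∈V suffix a≤l)
  suffix-∌-start sp 0<a a≤l x∈ =
    <⇒≱ 0<a (proj₁ (segment-∈V a≤l ≤-refl sp z≤n (subst (_∈V suffix a≤l) (sym vertexAt-zero) x∈)))

  EVsExists-prefix : Simple p → ∀ {b l} → b < len p → b ≤ l → EVsExists E x y l (vertexAt b)
  EVsExists-prefix sp b<l b≤l = prefix (<⇒≤ b<l) , (segment-simple z≤n (<⇒≤ b<l) sp , b≤l) , prefix-∌-end sp b<l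

  EVtExists-suffix : Simple p → ∀ {a l} → 0 < a → a ≤ len p → len p ∸ a ≤ l →
                     EVtExists E x y l (vertexAt a)
  EVtExists-suffix sp 0<a a≤l l∸a≤l =
    suffix a≤l , (segment-simple a≤l ≤-refl sp , l∸a≤l) , suffix-∌-start sp 0<a a≤l

  ¬InEVs-later : Simple p → ∀ {b m l} → b < m → m ≤ len p → b ≤ l →
                 ¬ InEVs E x y l (vertexAt b) (vertexAt m)
  ¬InEVs-later sp b<m m≤l b≤l essential =
    let q , q∈P* , y∉q = EVsExists-prefix sp b<l b≤l
    in <⇒≱ b<m (proj₂ (segment-∈V z≤n (<⇒≤ b<l) sp m≤l (essential q q∈P* y∉q)))
    where b<l = <-≤-trans b<m m≤l

  ¬InEVt-earlier : Simple p → ∀ {a m l} → m < a → a ≤ len p → len p ∸ a ≤ l →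
                   ¬ InEVt E x y l (vertexAt a) (vertexAt m)
  ¬InEVt-earlier sp m<a a≤l l∸a≤l essential =
    let q , q∈P* , x∉q = EVtExists-suffix sp (<-≤-trans (s≤s z≤n) m<a) a≤l l∸a≤l
    in <⇒≱ m<a (proj₁ (segment-∈V a≤l ≤-refl sp (≤-trans (<⇒≤ m<a) a≤l) (essential q q∈P* x∉q)))

module EdgesNearEnds {V : Set} {E : V → V → Set} {s t : V} (p : Path E s t) (sp : Simple p)
                     {k : ℕ} (l≤k : len p ≤ k) where
  open Segments p

  first-edge-definite : 0 < len p → DefiniteEdge E s t k (vertexAt 0) (vertexAt 1)
  first-edge-definite 0<l = vertexAt-step 0<l ,
    inj₁ (vertexAt-zero , ≤-trans 0<l l≤k , EVtExists-suffix sp ≤-refl 0<l (∸-monoˡ-≤ 1 l≤k))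

  second-edge-definite : 1 < len p → DefiniteEdge E s t k (vertexAt 1) (vertexAt 2)
  second-edge-definite 1<l = vertexAt-step 1<l , inj₂ (inj₂ (inj₁
    ( ≤-trans 1<l l≤k
    , EVsExists-prefix sp 1<l ≤-refl
    , EVtExists-suffix sp (s≤s z≤n) 1<l (∸-monoˡ-≤ 2 l≤k)
    , ¬InEVt-earlier sp (n<1+n 1) 1<l (∸-monoˡ-≤ 2 l≤k) )))

  penultimate-edge-definite : ∀ {j} → suc (suc j) ≡ len p →
                              DefiniteEdge E s t k (vertexAt j) (vertexAt (suc j))
  penultimate-edge-definite {j} 2+j≡l = vertexAt-step j<l , inj₂ (inj₂ (inj₂
    ( ≤-trans (subst (2 ≤_) 2+j≡l (s≤s (s≤s z≤n))) l≤k
    , EVtExists-suffix sp (s≤s z≤n) j<l (subst (λ n → n ∸ suc j ≤ 1) 2+j≡l (≤-reflexive (m+n∸n≡m 1 j)))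
    , EVsExists-prefix sp j<l j≤k∸2
    , ¬InEVs-later sp (n<1+n j) j<l j≤k∸2 )))
    where
    j<l : j < len p
    j<l = subst (j <_) 2+j≡l (n≤1+n (suc j))
    j≤k∸2 : j ≤ k ∸ 2
    j≤k∸2 = subst (λ n → n ∸ 2 ≤ k ∸ 2) (sym 2+j≡l) (∸-monoˡ-≤ 2 l≤k)

  last-edge-definite : ∀ {j} → suc j ≡ len p → DefiniteEdge E s t k (vertexAt j) (vertexAt (suc j))
  last-edge-definite {j} 1+j≡l = vertexAt-step j<l ,
    inj₂ (inj₁ ( trans (cong vertexAt 1+j≡l) vertexAt-len
               , ≤-trans (s≤s z≤n) (subst (_≤ k) (sym 1+j≡l) l≤k)
               , EVsExists-prefix sp j<l (subst (λ n → n ∸ 1 ≤ k ∸ 1) (sym 1+j≡l) (∸-monoˡ-≤ 1 l≤k)) ))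
    where
    j<l : j < len p
    j<l = ≤-reflexive 1+j≡l

  edge-near-ends-definite : ∀ j → j < len p → (j ≡ 0 ⊎ j ≡ 1 ⊎ suc (suc j) ≡ len p ⊎ suc j ≡ len p) →
                            DefiniteEdge E s t k (vertexAt j) (vertexAt (suc j))
  edge-near-ends-definite _ j<l (inj₁ refl)               = first-edge-definite j<l
  edge-near-ends-definite _ j<l (inj₂ (inj₁ refl))        = second-edge-definite j<l
  edge-near-ends-definite _ _   (inj₂ (inj₂ (inj₁ 2+j≡l))) = penultimate-edge-definite 2+j≡l
  edge-near-ends-definite _ _   (inj₂ (inj₂ (inj₂ 1+j≡l))) = last-edge-definite 1+j≡l

theorem9 : {V : Set} (E : V → V → Set) (s t : V) → ¬ (s ≡ t) →
    (k : ℕ) → 1 ≤ k →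
    (p : Path E s t) → Simple p → len p ≤ k →
    (i : Fin (len p)) →
    (toℕ i ≡ 0 ⊎ toℕ i ≡ 1 ⊎ suc (suc (toℕ i)) ≡ len p ⊎ suc (toℕ i) ≡ len p) →
    DefiniteEdge E s t k (vert p (inject₁ i)) (vert p (Fin.suc i))
theorem9 E s t _ k _ p sp l≤k i near-ends =
  subst₂ (DefiniteEdge E s t k)
    (sym (vert≡vertexAt (inject₁ i) (toℕ-inject₁ i)))
    (sym (vert≡vertexAt (Fin.suc i) refl))
    (edge-near-ends-definite (toℕ i) (toℕ<n i) near-ends)
  where
  open Segments p
  open EdgesNearEnds p sp l≤k
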